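{- Let $I\subseteq[n]$, $\overline J\subseteq[\overline n]$ be a valid pair. The map $T\mapsto\mathrm{prec}(T)$ is a bijection from the set of $(I,\overline J)$-trees to the set $\mathcal D_{I,\overline J}$.
   Context: Fix $n\ge1$, $[n]=\{1,\dots,n\}$, $[\overline n]=\{\overline1,\dots,\overline n\}$, ordered by $1\prec\overline1\prec2\prec\cdots\prec n\prec\overline n$. A pair $I\subseteq[n]$, $\overline J\subseteq[\overline n]$ is valid if $\min(I\sqcup\overline J)\in I$ and $\max(I\sqcup\overline J)\in\overline J$. Define $\mathrm{prec}:\overline J\to[n]$: if in $\prec$ restricted to $I\sqcup\overline J$ the element $\overline j$ is immediately preceded by some $i\in I$, then $\mathrm{prec}(\overline j)=i$; otherwise $\mathrm{prec}(\overline j)=j$. $A(I,\overline J)$ is the graph on $I\sqcup\overline J$ with arcs $(i,\overline j)$ for $i\in I$, $\overline j\in\overline J$, $i\prec\overline j$. An $(I,\overline J)$-forest is a subgraph of $A(I,\overline J)$ that is non-crossing, i.e. contains no two arcs $(i,\overline j),(i',\overline j')$ with $i\prec i'\prec\overline j\prec\overline j'$; an $(I,\overline J)$-tree is a maximal $(I,\overline J)$-forest. For a subgraph $T$ of $A(I,\overline J)$, $\mathrm{prec}(T)$ is its quotient identifying each $\overline j$ with $\mathrm{prec}(\overline j)$: the graph on vertex set $I\cup\mathrm{prec}(\overline J)\subseteq[n]$ with edges $(i,\mathrm{prec}(\overline j))$ for the arcs $(i,\overline j)$ of $T$ with $i\neq\mathrm{prec}(\overline j)$. A graph on a subset of $[n]$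 is alternating if it has no edges $(i,j),(j,k)$ with $i<j<k$, and non-crossing if it has no edges $(i,j),(i',j')$ with $i<i'<j<j'$. $\mathcal D_{I,\overline J}$ is the set of maximal (under inclusion) alternating non-crossing graphs on vertex set $I\cup\mathrm{prec}(\overline J)$ all of whose edges $(i,j)$, $i<j$, satisfy $i\in I$ and $j\in\mathrm{prec}(\overline J)$. -}

module Defs where

open import Data.Nat using (ℕ; suc; _*_) renaming (_<_ to _<ℕ_; _≤_ to _≤ℕ_)
open import Data.Fin using (Fin; toℕ; _<_; _≤_)
open import Data.Fin.Subset using (Subset; _∈_)
open import Data.Vec using (Vec; lookup)
open import Data.Bool using (Bool; true)
open import Data.Sum using (_⊎_; inj₁; inj₂)
open import Data.Product using (Σ; ∃; _×_)
open import Relation.Nullary using (¬_)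
open import Relation.Binary.PropositionalEquality using (_≡_; _≢_)

-- Elements of [n] ⊔ [n̄]:  inj₁ i  is  i,  inj₂ j  is  j̄  (0-indexed Fin n).
Elem : ℕ → Set
Elem n = Fin n ⊎ Fin n

-- Position in the order 1 ≺ 1̄ ≺ 2 ≺ 2̄ ≺ ⋯ ≺ n ≺ n̄.
key : ∀ {n} → Elem n → ℕ
key (inj₁ i) = 2 * toℕ i
key (inj₂ j) = suc (2 * toℕ j)

_≺_ : ∀ {n} → Elem n → Elem n → Set
x ≺ y = key x <ℕ key y

_≼_ : ∀ {n} → Elem n → Elem n → Set
x ≼ y = key x ≤ℕ key y

InS : ∀ {n} → Subset n → Subset n → Elem n → Set
InS I J (inj₁ i) = i ∈ I
InS I J (inj₂ j) = j ∈ J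

IsMin : ∀ {n} → Subset n → Subset n → Elem n → Set
IsMin I J x = InS I J x × (∀ y → InS I J y → x ≼ y)

IsMax : ∀ {n} → Subset n → Subset n → Elem n → Set
IsMax I J x = InS I J x × (∀ y → InS I J y → y ≼ x)

Valid : ∀ {n} → Subset n → Subset n → Set
Valid I J = (∃ λ i → IsMin I J (inj₁ i)) × (∃ λ j → IsMax I J (inj₂ j))

ImmPrecedes : ∀ {n} → Subset n → Subset n → Elem n → Elem n → Set
ImmPrecedes I J x y =
  InS I J x × InS I J y × x ≺ y × (∀ z → InS I J z → ¬ (x ≺ z × z ≺ y))

-- Prec I J j k  :  prec(j̄) = k
Prec : ∀ {n} → Subset n → Subset n → Fin n → Fin n → Set
Prec I J j k =
  (k ∈ I × ImmPrecedes I J (inj₁ k) (inj₂ j))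
  ⊎ ((∀ i → ¬ (i ∈ I × ImmPrecedes I J (inj₁ i) (inj₂ j))) × k ≡ j)

InPrecJ : ∀ {n} → Subset n → Subset n → Fin n → Set
InPrecJ I J k = ∃ λ j → j ∈ J × Prec I J j k

Mat : ℕ → Set
Mat n = Vec (Vec Bool n) n

_⟦_,_⟧ : ∀ {n} → Mat n → Fin n → Fin n → Set
M ⟦ a , b ⟧ = lookup (lookup M a) b ≡ true

_⊆M_ : ∀ {n} → Mat n → Mat n → Set
M ⊆M M' = ∀ a b → M ⟦ a , b ⟧ → M' ⟦ a , b ⟧

-- (I,J̄)-arc sets:  T ⟦ i , j ⟧  means the arc (i , j̄).
-- T is a subgraph of A(I,J̄):
SubA : ∀ {n} → Subset n → Subset n → Mat n → Set
SubA I J T = ∀ i j → T ⟦ i , j ⟧ → i ∈ I × j ∈ J × inj₁ i ≺ inj₂ j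

NonCrossingA : ∀ {n} → Mat n → Set
NonCrossingA T = ∀ i j i' j' → T ⟦ i , j ⟧ → T ⟦ i' , j' ⟧ →
  ¬ (inj₁ i ≺ inj₁ i' × inj₁ i' ≺ inj₂ j × inj₂ j ≺ inj₂ j')

IsForest : ∀ {n} → Subset n → Subset n → Mat n → Set
IsForest I J T = SubA I J T × NonCrossingA T

IsTree : ∀ {n} → Subset n → Subset n → Mat n → Set
IsTree I J T = IsForest I J T × (∀ T' → IsForest I J T' → T ⊆M T' → T' ⊆M T)

-- Graphs on a subset of [n]:  G ⟦ a , b ⟧  with a < b  means the edge (a , b).
-- G = prec(T):
PrecOf : ∀ {n} → Subset n → Subset n → Mat n → Mat n → Set
PrecOf I J T G = ∀ a b →
  (G ⟦ a , b ⟧ → a < b × PrecEdge a b) × (a < b × PrecEdge a b → G ⟦ a , b ⟧)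
  where
  PrecEdge : _ → _ → Set
  PrecEdge a b = Σ _ λ i → Σ _ λ j → Σ _ λ p →
    T ⟦ i , j ⟧ × Prec I J j p × i ≢ p × ((a ≡ i × b ≡ p) ⊎ (a ≡ p × b ≡ i))

EdgesOK : ∀ {n} → Subset n → Subset n → Mat n → Set
EdgesOK I J G = ∀ a b → G ⟦ a , b ⟧ → a < b × a ∈ I × InPrecJ I J b

Alternating : ∀ {n} → Mat n → Set
Alternating G = ∀ i j k → i < j → j < k → ¬ (G ⟦ i , j ⟧ × G ⟦ j , k ⟧)

NonCrossing : ∀ {n} → Mat n → Set
NonCrossing G = ∀ i j i' j' → i < i' → i' < j → j < j' →
  ¬ (G ⟦ i , j ⟧ × G ⟦ i' , j' ⟧)

Admissible : ∀ {n} → Subset n → Subset n → Mat n → Set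
Admissible I J G = EdgesOK I J G × Alternating G × NonCrossing G

InD : ∀ {n} → Subset n → Subset n → Mat n → Set
InD I J G = Admissible I J G × (∀ G' → Admissible I J G' → G ⊆M G' → G' ⊆M G)

{-# OPTIONS --safe #-}
module Submission where

-- Every arc (i, x̄) of an (I,J̄)-forest is either collapsed by prec (i = prec x̄) or
-- projects to the edge (i, prec x̄) of prec(T).  Conversely, for an admissible graph G,
-- the arc set lift G of all arcs of these two kinds is an (I,J̄)-forest: a crossing in it
-- would give a crossing or a non-alternating pair of edges in G, or would contradict
-- that prec x̄ immediately precedes x̄.  Hence every tree T equals lift (prec T), which
-- gives injectivity, and since lift and prec are monotone, maximality of T and of prec T
-- imply each other.

open import Defs
open import Data.Nat using (ℕ; _*_; s≤s; s≤s⁻¹; s<s⁻¹) renaming (_<?_ to _<ℕ?_)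
import Data.Nat.Properties as ℕ
open import Data.Fin using (Fin; toℕ; _<_; _≤_; _≟_; _<?_)
open import Data.Fin.Properties using (any?; all?; ≤-antisym; <-cmp; <⇒≢; ≤∧≢⇒<; <-irrefl; <-asym)
open import Data.Fin.Subset using (Subset; _∈_)
open import Data.Fin.Subset.Properties using (_∈?_)
open import Data.Vec using (lookup; tabulate)
open import Data.Vec.Properties using (lookup∘tabulate; tabulate∘lookup; tabulate-cong)
open import Data.Bool using (Bool; true; false)
open import Data.Bool.Properties using (T-≡) renaming (_≟_ to _≟ᴮ_)
open import Data.Sum using (_⊎_; inj₁; inj₂)
open import Data.Product using (Σ; ∃; _×_; _,_; proj₁; proj₂)
open import Data.Empty using (⊥-elim)
open import Function using (_∘_)
open import Function.Bundles using (Equivalence)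
open import Relation.Nullary using (¬_; Dec; yes; no)
open import Relation.Nullary.Decidable using (_×-dec_; _⊎-dec_; _→-dec_; ¬?; isYes; toWitness; fromWitness)
open import Relation.Binary.PropositionalEquality using (_≡_; _≢_; refl; sym; trans; cong)
open import Relation.Binary using (tri<; tri≈; tri>)

module _ {n : ℕ} {a b : Fin n} where

  ≺⇒<₁ : inj₁ a ≺ inj₁ b → a < b
  ≺⇒<₁ h = ℕ.≰⇒> (λ b≤a → ℕ.<⇒≱ h (ℕ.*-monoʳ-≤ 2 b≤a))

  <⇒≺₁ : a < b → inj₁ a ≺ inj₁ b
  <⇒≺₁ = ℕ.*-monoʳ-< 2

  ≺⇒≤₁₂ : inj₁ a ≺ inj₂ b → a ≤ b
  ≺⇒≤₁₂ h = ℕ.≮⇒≥ (λ b<a → ℕ.<⇒≱ h (ℕ.*-monoʳ-< 2 b<a))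

  ≤⇒≺₁₂ : a ≤ b → inj₁ a ≺ inj₂ b
  ≤⇒≺₁₂ h = s≤s (ℕ.*-monoʳ-≤ 2 h)

  ≺⇒<₂ : inj₂ a ≺ inj₂ b → a < b
  ≺⇒<₂ h = ≺⇒<₁ (s<s⁻¹ h)

  <⇒≺₂ : a < b → inj₂ a ≺ inj₂ b
  <⇒≺₂ h = s≤s (<⇒≺₁ h)

≺-adjacent : ∀ {n} (a : Fin n) z → ¬ (inj₁ a ≺ z × z ≺ inj₂ a)
≺-adjacent a z (a≺z , z≺ā) = ℕ.<⇒≱ a≺z (s≤s⁻¹ z≺ā)

module _ {n : ℕ} where

  abstract
    tabulateMat : (P : Fin n → Fin n → Set) → (∀ a b → Dec (P a b)) → Mat n
    tabulateMat P P? = tabulate λ a → tabulate λ b → isYes (P? a b)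

    lookup-tabulateMat : ∀ P P? (a b : Fin n) →
      lookup (lookup (tabulateMat P P?) a) b ≡ isYes (P? a b)
    lookup-tabulateMat P P? a b =
      trans (cong (λ row → lookup row b) (lookup∘tabulate _ a)) (lookup∘tabulate _ b)

    tabulateMat-sound : ∀ P P? (a b : Fin n) → tabulateMat P P? ⟦ a , b ⟧ → P a b
    tabulateMat-sound P P? a b h =
      toWitness (Equivalence.from T-≡ (trans (sym (lookup-tabulateMat P P? a b)) h))

    tabulateMat-complete : ∀ P P? (a b : Fin n) → P a b → tabulateMat P P? ⟦ a , b ⟧
    tabulateMat-complete P P? a b p =
      trans (lookup-tabulateMat P P? a b) (Equivalence.to T-≡ (fromWitness p))

  _⟦_,_⟧? : (M : Mat n) → ∀ a b → Dec (M ⟦ a , b ⟧)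
  M ⟦ a , b ⟧? = lookup (lookup M a) b ≟ᴮ true

  private
    ≡true-ext : {x y : Bool} → (x ≡ true → y ≡ true) → (y ≡ true → x ≡ true) → x ≡ y
    ≡true-ext {true}  {true}  _ _ = refl
    ≡true-ext {true}  {false} f _ = sym (f refl)
    ≡true-ext {false} {true}  _ g = g refl
    ≡true-ext {false} {false} _ _ = refl

  ⊆M-antisym : {M M' : Mat n} → M ⊆M M' → M' ⊆M M → M ≡ M'
  ⊆M-antisym {M} {M'} f g =
    trans (sym (tabulate∘lookup M)) (trans (tabulate-cong rows) (tabulate∘lookup M'))
    where
    rows : ∀ a → lookup M a ≡ lookup M' a
    rows a = trans (sym (tabulate∘lookup (lookup M a)))
      (trans (tabulate-cong (λ b → ≡true-ext (f a b) (g a b))) (tabulate∘lookup (lookup M' a)))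

module PrecProperties {n : ℕ} (I J : Subset n) where

  InS? : ∀ z → Dec (InS I J z)
  InS? (inj₁ i) = i ∈? I
  InS? (inj₂ j) = j ∈? J

  ∀-Elem? : {P : Elem n → Set} → (∀ z → Dec (P z)) → Dec (∀ z → P z)
  ∀-Elem? P? with all? (P? ∘ inj₁) | all? (P? ∘ inj₂)
  ... | yes p | yes q = yes λ { (inj₁ i) → p i ; (inj₂ j) → q j }
  ... | no ¬p | _     = no λ h → ¬p (h ∘ inj₁)
  ... | yes _ | no ¬q = no λ h → ¬q (h ∘ inj₂)

  _≺?_ : (x y : Elem n) → Dec (x ≺ y)
  x ≺? y = key x <ℕ? key y

  ImmPrecedes? : ∀ x y → Dec (ImmPrecedes I J x y)
  ImmPrecedes? x y = InS? x ×-dec (InS? y ×-dec ((x ≺? y) ×-dec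
    ∀-Elem? (λ z → InS? z →-dec ¬? ((x ≺? z) ×-dec (z ≺? y)))))

  ImmPrecedesᴵ : Fin n → Fin n → Set
  ImmPrecedesᴵ k j = k ∈ I × ImmPrecedes I J (inj₁ k) (inj₂ j)

  ImmPrecedesᴵ? : ∀ k j → Dec (ImmPrecedesᴵ k j)
  ImmPrecedesᴵ? k j = (k ∈? I) ×-dec ImmPrecedes? (inj₁ k) (inj₂ j)

  Prec? : ∀ j k → Dec (Prec I J j k)
  Prec? j k = ImmPrecedesᴵ? k j ⊎-dec (all? (λ i → ¬? (ImmPrecedesᴵ? i j)) ×-dec (k ≟ j))

  prec-total : ∀ j → ∃ (Prec I J j)
  prec-total j with any? (λ i → ImmPrecedesᴵ? i j)
  ... | yes (i , h) = i , inj₁ h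
  ... | no ¬h       = j , inj₂ ((λ i h → ¬h (i , h)) , refl)

  prec-functional : ∀ {j p q} → Prec I J j p → Prec I J j q → p ≡ q
  prec-functional {p = p} {q} (inj₁ (pI , _ , _ , p≺j , p-imm)) (inj₁ (qI , _ , _ , q≺j , q-imm)) =
    ≤-antisym (ℕ.≮⇒≥ (λ q<p → q-imm (inj₁ p) pI (<⇒≺₁ q<p , p≺j)))
              (ℕ.≮⇒≥ (λ p<q → p-imm (inj₁ q) qI (<⇒≺₁ p<q , q≺j)))
  prec-functional {p = p} (inj₁ h) (inj₂ (¬imm , refl)) = ⊥-elim (¬imm p h)
  prec-functional {q = q} (inj₂ (¬imm , refl)) (inj₁ h) = ⊥-elim (¬imm q h)
  prec-functional (inj₂ (_ , refl)) (inj₂ (_ , refl)) = refl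

  prec-≤ : ∀ {j p} → Prec I J j p → p ≤ j
  prec-≤ (inj₁ (_ , _ , _ , p≺j , _)) = ≺⇒≤₁₂ p≺j
  prec-≤ (inj₂ (_ , refl))            = ℕ.≤-refl

  ≤-prec : ∀ {i j p} → i ∈ I → i ≤ j → Prec I J j p → i ≤ p
  ≤-prec {i} iI i≤j (inj₁ (_ , _ , _ , _ , p-imm)) =
    ℕ.≮⇒≥ (λ p<i → p-imm (inj₁ i) iI (<⇒≺₁ p<i , ≤⇒≺₁₂ i≤j))
  ≤-prec iI i≤j (inj₂ (_ , refl)) = i≤j

  prec∈I⇒immPrecedes : ∀ {j p} → p ∈ I → j ∈ J → Prec I J j p → ImmPrecedesᴵ p j
  prec∈I⇒immPrecedes pI jJ (inj₁ h) = h
  prec∈I⇒immPrecedes {j} pI jJ (inj₂ (¬imm , refl)) =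
    ⊥-elim (¬imm j (pI , pI , jJ , ℕ.n<1+n (2 * toℕ j) , λ z _ → ≺-adjacent j z))

  prec-strictMono : ∀ {x y p q} → x ∈ J → x < y → Prec I J x p → Prec I J y q → p < q
  prec-strictMono {x} xJ x<y x↦p (inj₁ (_ , _ , _ , _ , q-imm)) =
    ℕ.≤-<-trans (prec-≤ x↦p) (ℕ.≰⇒> (λ q≤x → q-imm (inj₂ x) xJ (≤⇒≺₁₂ q≤x , <⇒≺₂ x<y)))
  prec-strictMono xJ x<y x↦p (inj₂ (_ , refl)) = ℕ.≤-<-trans (prec-≤ x↦p) x<y

  prec-reflects-< : ∀ {x y p q} → x ∈ J → y ∈ J → Prec I J x p → Prec I J y q → p < q → x < y
  prec-reflects-< {x} {y} xJ yJ x↦p y↦q p<q with <-cmp x y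
  ... | tri< x<y _ _ = x<y
  ... | tri≈ _ refl _ = ⊥-elim (<-irrefl (prec-functional x↦p y↦q) p<q)
  ... | tri> _ _ y<x = ⊥-elim (<-asym p<q (prec-strictMono yJ y<x y↦q x↦p))

  immPrecedes-first : ∀ {x y b c} → b ∈ I → x ∈ J → Prec I J x b → b ≤ y → y ∈ J →
                      Prec I J y c → b < c → x < y
  immPrecedes-first {x} {y} bI xJ x↦b b≤y yJ y↦c b<c
    with prec∈I⇒immPrecedes bI xJ x↦b
  ... | _ , _ , _ , _ , b-imm with x ≟ y
  ...   | yes refl = ⊥-elim (<-irrefl (prec-functional x↦b y↦c) b<c)
  ...   | no x≢y = ≤∧≢⇒< (ℕ.≮⇒≥ (λ y<x → b-imm (inj₂ y) yJ (≤⇒≺₁₂ b≤y , <⇒≺₂ y<x))) x≢y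

-- PrecOf I J T G does not determine T and G by unification, hence the explicit
-- implicit arguments below.
module Correspondence {n : ℕ} (I J : Subset n) where
  open PrecProperties I J

  PrecEdge : Mat n → Fin n → Fin n → Set
  PrecEdge T a b = Σ (Fin n) λ i → Σ (Fin n) λ j → Σ (Fin n) λ p →
    T ⟦ i , j ⟧ × Prec I J j p × i ≢ p × ((a ≡ i × b ≡ p) ⊎ (a ≡ p × b ≡ i))

  PrecEdge? : ∀ T a b → Dec (PrecEdge T a b)
  PrecEdge? T a b = any? λ i → any? λ j → any? λ p → T ⟦ i , j ⟧? ×-dec (Prec? j p ×-dec
    (¬? (i ≟ p) ×-dec ((a ≟ i ×-dec b ≟ p) ⊎-dec (a ≟ p ×-dec b ≟ i))))

  abstract
    precImage : Mat n → Mat n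
    precImage T = tabulateMat (λ a b → a < b × PrecEdge T a b) (λ a b → (a <? b) ×-dec PrecEdge? T a b)

    precImage-precOf : ∀ T → PrecOf I J T (precImage T)
    precImage-precOf T a b = tabulateMat-sound _ _ a b , tabulateMat-complete _ _ a b

  ArcOver : Mat n → Fin n → Fin n → Set
  ArcOver T a b = ∃ λ x → T ⟦ a , x ⟧ × Prec I J x b

  precOf⇒arcOver : ∀ {T G a b} → SubA I J T → PrecOf I J T G → G ⟦ a , b ⟧ → a < b × ArcOver T a b
  precOf⇒arcOver {a = a} {b} sub po g with proj₁ (po a b) g
  ... | a<b , (_ , x , _ , arc , x↦b , _ , inj₁ (refl , refl)) = a<b , x , arc , x↦b
  ... | a<b , (i , x , _ , arc , x↦a , _ , inj₂ (refl , refl)) with sub i x arc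
  ...   | iI , _ , i≺x = ⊥-elim (ℕ.<⇒≱ a<b (≤-prec iI (≺⇒≤₁₂ i≺x) x↦a))

  arcOver⇒precOf : ∀ {T G a b x} → PrecOf I J T G → a < b → T ⟦ a , x ⟧ → Prec I J x b → G ⟦ a , b ⟧
  arcOver⇒precOf {a = a} {b} po a<b arc x↦b =
    proj₂ (po a b) (a<b , a , _ , b , arc , x↦b , <⇒≢ a<b , inj₁ (refl , refl))

  precOf-admissible : ∀ {T G} → IsForest I J T → PrecOf I J T G → Admissible I J G
  precOf-admissible {T} {G} (sub , nc) po = edgesOK , alternating , nonCrossing
    where
    edge : ∀ {a b} → G ⟦ a , b ⟧ → a < b × ArcOver T a b
    edge {a} {b} = precOf⇒arcOver {T} {G} {a} {b} sub po

    edgesOK : EdgesOK I J G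
    edgesOK a b g with edge g
    ... | a<b , x , arc , x↦b with sub a x arc
    ...   | aI , xJ , _ = a<b , aI , x , xJ , x↦b

    alternating : Alternating G
    alternating i j k i<j j<k (g₁ , g₂) with edge g₁ | edge g₂
    ... | _ , x , arc₁ , x↦j | _ , y , arc₂ , y↦k with sub i x arc₁ | sub j y arc₂
    ...   | _ , xJ , _ | jI , yJ , j≺y =
      nc i x j y arc₁ arc₂ (<⇒≺₁ i<j , ≤⇒≺₁₂ (prec-≤ x↦j) ,
        <⇒≺₂ (immPrecedes-first jI xJ x↦j (≺⇒≤₁₂ j≺y) yJ y↦k j<k))

    nonCrossing : NonCrossing G
    nonCrossing a b a' b' a<a' a'<b b<b' (g₁ , g₂) with edge g₁ | edge g₂
    ... | _ , x , arc₁ , x↦b | _ , y , arc₂ , y↦b' with sub a x arc₁ | sub a' y arc₂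
    ...   | _ , xJ , _ | _ , yJ , _ =
      nc a x a' y arc₁ arc₂ (<⇒≺₁ a<a' , ≤⇒≺₁₂ (ℕ.<⇒≤ (ℕ.<-≤-trans a'<b (prec-≤ x↦b))) ,
        <⇒≺₂ (prec-reflects-< xJ yJ x↦b y↦b' b<b'))

  Liftable : Mat n → Fin n → Fin n → Set
  Liftable G i x = i ∈ I × x ∈ J × (Prec I J x i ⊎ ∃ λ p → Prec I J x p × G ⟦ i , p ⟧)

  Liftable? : ∀ G i x → Dec (Liftable G i x)
  Liftable? G i x = (i ∈? I) ×-dec ((x ∈? J) ×-dec (Prec? x i ⊎-dec (any? λ p → Prec? x p ×-dec G ⟦ i , p ⟧?)))

  abstract
    lift : Mat n → Mat n
    lift G = tabulateMat (Liftable G) (Liftable? G)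

    lift-sound : ∀ {G i x} → lift G ⟦ i , x ⟧ → Liftable G i x
    lift-sound {G} {i} {x} = tabulateMat-sound (Liftable G) (Liftable? G) i x

    lift-complete : ∀ {G i x} → Liftable G i x → lift G ⟦ i , x ⟧
    lift-complete {G} {i} {x} = tabulateMat-complete (Liftable G) (Liftable? G) i x

  lift-mono : ∀ {G G'} → G ⊆M G' → lift G ⊆M lift G'
  lift-mono G⊆G' i x l with lift-sound l
  ... | iI , xJ , inj₁ x↦i = lift-complete (iI , xJ , inj₁ x↦i)
  ... | iI , xJ , inj₂ (p , x↦p , g) = lift-complete (iI , xJ , inj₂ (p , x↦p , G⊆G' i p g))

  lift-subA : ∀ {G} → EdgesOK I J G → SubA I J (lift G)
  lift-subA edgesOK i x l with lift-sound l
  ... | iI , xJ , inj₁ x↦i = iI , xJ , ≤⇒≺₁₂ (prec-≤ x↦i)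
  ... | iI , xJ , inj₂ (p , x↦p , g) =
    iI , xJ , ≤⇒≺₁₂ (ℕ.<⇒≤ (ℕ.<-≤-trans (proj₁ (edgesOK i p g)) (prec-≤ x↦p)))

  lift-nonCrossing : ∀ {G} → Admissible I J G → NonCrossingA (lift G)
  lift-nonCrossing (_ , alternating , nonCrossing) i x i' y l₁ l₂ (i≺i' , i'≺x , x≺y)
    with lift-sound l₁ | lift-sound l₂
  ... | iI , xJ , inj₁ x↦i | i'I , _ , _ with prec∈I⇒immPrecedes iI xJ x↦i
  ...   | _ , _ , _ , _ , i-imm = i-imm (inj₁ i') i'I (i≺i' , i'≺x)
  lift-nonCrossing _ i x i' y _ _ (_ , i'≺x , x≺y)
      | _ , xJ , inj₂ _ | i'I , yJ , inj₁ y↦i' with prec∈I⇒immPrecedes i'I yJ y↦i'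
  ...   | _ , _ , _ , _ , i'-imm = i'-imm (inj₂ x) xJ (i'≺x , x≺y)
  lift-nonCrossing (_ , alternating , nonCrossing) i x i' y _ _ (i≺i' , i'≺x , x≺y)
      | _ , xJ , inj₂ (p , x↦p , g₁) | i'I , yJ , inj₂ (q , y↦q , g₂)
    with prec-strictMono xJ (≺⇒<₂ x≺y) x↦p y↦q | i' ≟ p
  ... | p<q | yes refl = alternating i i' q (≺⇒<₁ i≺i') p<q (g₁ , g₂)
  ... | p<q | no i'≢p =
    nonCrossing i p i' q (≺⇒<₁ i≺i') (≤∧≢⇒< (≤-prec i'I (≺⇒≤₁₂ i'≺x) x↦p) i'≢p) p<q (g₁ , g₂)

  lift-isForest : ∀ {G} → Admissible I J G → IsForest I J (lift G)
  lift-isForest adm = lift-subA (proj₁ adm) , lift-nonCrossing adm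

  subA⊆lift : ∀ {T G} → SubA I J T → PrecOf I J T G → T ⊆M lift G
  subA⊆lift {T} {G} sub po i x arc with sub i x arc | prec-total x
  ... | iI , xJ , i≺x | p , x↦p with i ≟ p
  ...   | yes refl = lift-complete (iI , xJ , inj₁ x↦p)
  ...   | no i≢p = lift-complete (iI , xJ , inj₂ (p , x↦p , arcOver⇒precOf {T} {G} po i<p arc x↦p))
    where i<p = ≤∧≢⇒< (≤-prec iI (≺⇒≤₁₂ i≺x) x↦p) i≢p

  lift⊆⇒⊆precOf : ∀ {G T G'} → EdgesOK I J G → lift G ⊆M T → PrecOf I J T G' → G ⊆M G'
  lift⊆⇒⊆precOf {G} {T} {G'} edgesOK lift⊆T po a b g with edgesOK a b g
  ... | a<b , aI , x , xJ , x↦b =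
    arcOver⇒precOf {T} {G'} po a<b (lift⊆T a x (lift-complete (aI , xJ , inj₂ (b , x↦b , g)))) x↦b

  precOf-lift : ∀ {G} → EdgesOK I J G → PrecOf I J (lift G) G
  precOf-lift {G} edgesOK a b = edge⇒precEdge , precEdge⇒edge
    where
    edge⇒precEdge : G ⟦ a , b ⟧ → a < b × PrecEdge (lift G) a b
    edge⇒precEdge g with edgesOK a b g
    ... | a<b , aI , x , xJ , x↦b =
      a<b , a , x , b , lift-complete (aI , xJ , inj₂ (b , x↦b , g)) , x↦b , <⇒≢ a<b , inj₁ (refl , refl)

    precEdge⇒edge : a < b × PrecEdge (lift G) a b → G ⟦ a , b ⟧
    precEdge⇒edge (a<b , i , x , p , l , x↦p , i≢p , ends) with lift-sound l
    ... | _ , _ , inj₁ x↦i = ⊥-elim (i≢p (prec-functional x↦i x↦p))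
    ... | _ , _ , inj₂ (p' , x↦p' , g) with prec-functional x↦p' x↦p | ends
    ...   | refl | inj₁ (refl , refl) = g
    ...   | refl | inj₂ (refl , refl) = ⊥-elim (<-asym a<b (proj₁ (edgesOK i p g)))

  tree≡lift : ∀ {T G} → IsTree I J T → PrecOf I J T G → T ≡ lift G
  tree≡lift {T} {G} (forest , maximal) po =
    ⊆M-antisym T⊆lift (maximal (lift G) (lift-isForest (precOf-admissible {T} {G} forest po)) T⊆lift)
    where
    T⊆lift : T ⊆M lift G
    T⊆lift = subA⊆lift {T} {G} (proj₁ forest) po

  precOf-InD : ∀ {T G} → IsTree I J T → PrecOf I J T G → InD I J G
  precOf-InD {T} {G} (forest , maximal) po = precOf-admissible {T} {G} forest po , G-maximal
    where
    G-maximal : ∀ G' → Admissible I J G' → G ⊆M G' → G' ⊆M G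
    G-maximal G' adm' G⊆G' = lift⊆⇒⊆precOf {G'} {T} {G} (proj₁ adm') lift'⊆T po
      where
      T⊆lift' : T ⊆M lift G'
      T⊆lift' a b t = lift-mono G⊆G' a b (subA⊆lift {T} {G} (proj₁ forest) po a b t)

      lift'⊆T : lift G' ⊆M T
      lift'⊆T = maximal (lift G') (lift-isForest adm') T⊆lift'

  lift-isTree : ∀ {G} → InD I J G → IsTree I J (lift G)
  lift-isTree {G} (adm , maximal) = lift-isForest adm , lift-maximal
    where
    lift-maximal : ∀ T → IsForest I J T → lift G ⊆M T → T ⊆M lift G
    lift-maximal T forest lift⊆T a b t =
      lift-mono G'⊆G a b (subA⊆lift {T} {precImage T} (proj₁ forest) po a b t)
      where
      po : PrecOf I J T (precImage T)
      po = precImage-precOf T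

      G'⊆G : precImage T ⊆M G
      G'⊆G = maximal (precImage T) (precOf-admissible {T} {precImage T} forest po)
        (lift⊆⇒⊆precOf {G} {T} {precImage T} (proj₁ adm) lift⊆T po)

lemma4p3 : (n : ℕ) (I J : Subset n) → Valid I J →
    ((T : Mat n) → IsTree I J T → Σ (Mat n) λ G → PrecOf I J T G × InD I J G)
    × ((T T' G : Mat n) → IsTree I J T → IsTree I J T' →
        PrecOf I J T G → PrecOf I J T' G → T ≡ T')
    × ((G : Mat n) → InD I J G → Σ (Mat n) λ T → IsTree I J T × PrecOf I J T G)
lemma4p3 n I J _ = image , injective , surjective
  where
  open Correspondence I J

  image : (T : Mat n) → IsTree I J T → Σ (Mat n) λ G → PrecOf I J T G × InD I J G
  image T tree =
    precImage T , precImage-precOf T , precOf-InD {T} {precImage T} tree (precImage-precOf T)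

  injective : (T T' G : Mat n) → IsTree I J T → IsTree I J T' →
              PrecOf I J T G → PrecOf I J T' G → T ≡ T'
  injective T T' G tree tree' po po' =
    trans (tree≡lift {T} {G} tree po) (sym (tree≡lift {T'} {G} tree' po'))

  surjective : (G : Mat n) → InD I J G → Σ (Mat n) λ T → IsTree I J T × PrecOf I J T G
  surjective G inD = lift G , lift-isTree inD , precOf-lift (proj₁ (proj₁ inD))
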